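{- Let $n,k,m,r$ be positive integers with $r<k\le m$ and $n\geq \left\lfloor\frac{k-1}{r}\right\rfloor{m\choose k-1}$. Let $\mathcal B=\{B_1,\dots,B_n\}$ be a family of subsets of $[m]$ in which the first $\left\lfloor\frac{k-1}{r}\right\rfloor{m\choose k-1}$ blocks consist of exactly $\left\lfloor\frac{k-1}{r}\right\rfloor$ copies of each $(k-1)$-subset of $[m]$, and each remaining block is an arbitrary $k$-subset of $[m]$. For $j\in[m]$ let $C_j=\{i\in[n]: j\in B_i\}$. Then $\{C_1,\dots,C_m\}$ is an $(n,N,k,m;r)$-MCBC with $N=kn-\left\lfloor\frac{k-1}{r}\right\rfloor{m\choose k-1}$.
   Context: An $(n,N,k,m;r)$ multiset combinatorial batch code (MCBC) is a collection $\mathcal C=\{C_1,\dots,C_m\}$ of subsets of $[n]=\{1,\dots,n\}$ (servers) with $N=\sum_{j=1}^m|C_j|$, such that for every multiset request $\{i_1,\dots,i_k\}$ of $k$ elements of $[n]$ in which every element has multiplicity at most $r$, there exist subsets $D_j\subseteq C_j$ with $|D_j|\le 1$ ($j\in[m]$) whose multiset union (the multiplicity of $i$ being $|\{j: i\in D_j\}|$) contains the request. -}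

module Defs where

open import Data.Nat using (ℕ; zero; suc; _+_; _*_; _∸_; _≤_; _<_)
open import Data.Bool using (Bool; true; false; if_then_else_)
open import Data.Fin using (Fin; toℕ)
import Data.Fin as Fin
open import Data.Fin.Subset using (Subset; _∈_; ∣_∣)
open import Data.Vec using (Vec; lookup; tabulate)
import Data.Vec.Properties as VecP
import Data.Bool.Properties as BoolP
open import Data.Maybe using (Maybe; just; nothing)
open import Data.List using (allFin; map)
open import Data.Nat.ListAction using (sum)
open import Data.Product using (Σ; _×_)
open import Relation.Nullary using (does)
open import Relation.Binary.PropositionalEquality using (_≡_)

sumFin : {n : ℕ} → (Fin n → ℕ) → ℕ
sumFin {n} f = sum (map f (allFin n))

countFin : {n : ℕ} → (Fin n → Bool) → ℕ
countFin P = sumFin (λ x → if P x then 1 else 0)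

_≟ˢ_ : {m : ℕ} → (S T : Subset m) → Bool
S ≟ˢ T = does (VecP.≡-dec BoolP._≟_ S T)

-- |D_j| ≤ 1 : D_j is either empty (nothing) or a single element (just i).
-- multiplicity of item i in D_j
hits : {n : ℕ} → Maybe (Fin n) → Fin n → ℕ
hits nothing  i = 0
hits (just i') i = if does (i' Fin.≟ i) then 1 else 0

-- A multiset request of size k over [n] with multiplicities ≤ r,
-- given by its multiplicity function q.
IsRequest : (n k r : ℕ) → (Fin n → ℕ) → Set
IsRequest n k r q = (sumFin q ≡ k) × (∀ i → q i ≤ r)

-- The request q can be served from servers C : Fin m → Subset n:
-- choose D_j ⊆ C_j with |D_j| ≤ 1 so that the multiset union contains q.
Serves : {n m : ℕ} → (Fin m → Subset n) → (Fin n → ℕ) → Set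
Serves {n} {m} Cs q =
  Σ (Fin m → Maybe (Fin n)) λ d →
    (∀ j i → d j ≡ just i → i ∈ Cs j) ×
    (∀ i → q i ≤ sumFin (λ j → hits (d j) i))

IsMCBC : (n N k m r : ℕ) → (Fin m → Subset n) → Set
IsMCBC n N k m r Cs =
  (N ≡ sumFin (λ j → ∣ Cs j ∣)) ×
  (∀ (q : Fin n → ℕ) → IsRequest n k r q → Serves Cs q)

dualFamily : {n m : ℕ} → (Fin n → Subset m) → Fin m → Subset n
dualFamily B j = tabulate (λ i → lookup (B i) j)

module Submission where

-- The argument is greedy: a partial assignment can
-- always serve one more copy of item i while some server of B_i is idle, so a
-- request of size t is served as long as every requested block has t more
-- servers than are busy.  Every block has at least k - 1 servers, hence
--   * if some requested item has a k-block, serve the other k - 1 copies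
--     greedily and this item last (k - 1 busy servers < k);
--   * if two requested items i₀, i₁ have different (k-1)-blocks, pick
--     e ∈ B_{i₁} ∖ B_{i₀}, let e serve i₁ first, the rest greedily and i₀ last:
--     B_{i₀} is not exhausted since the busy server e lies outside it;
--   * otherwise all requested items are among the ⌊(k-1)/r⌋ copies of one
--     (k-1)-set, so the request has size ≤ r ⌊(k-1)/r⌋ < k, a contradiction.

open import Defs
open import Data.Nat using (ℕ; NonZero; zero; suc; _+_; _*_; _∸_; _≤_; _<_; _≥_; z≤n; s≤s; z<s; _<ᵇ_; _<?_; _≤?_)
open import Data.Nat.Properties hiding (_≟_)
open import Data.Nat.DivMod using (_/_; m/n*n≤m)
open import Data.Nat.Combinatorics using (_C_)
open import Data.Bool using (Bool; true; false; _∧_; if_then_else_)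
import Data.Bool as Bool
open import Data.Fin using (Fin; toℕ; zero; suc; _≟_)
open import Data.Fin.Properties using (any?; ¬∀⟶∃¬)
open import Data.Fin.Subset using (Subset; ∣_∣; _∈_; _∉_; _⊆_; _∪_; ⁅_⁆; _-_) renaming (⊥ to ⊥ˢ)
open import Data.Fin.Subset.Properties
  using (_∈?_; drop-∷-⊆; p⊆q⇒∣p∣≤∣q∣; x∈⁅x⁆; x∈p∪q⁺; x∈p∧x≢y⇒x∈p-y; x∈p⇒∣p-x∣<∣p∣; ∣⊥∣≡0; ∪-identityʳ)
open import Data.Maybe using (Maybe; just; nothing; is-just)
import Data.List as List
open import Data.List.Properties using (map-tabulate)
import Data.Nat.ListAction as ListAction
open import Data.Vec using ([]; _∷_; lookup; tabulate; here)
open import Data.Vec.Properties using (lookup∘tabulate; lookup⇒[]=; []=⇒lookup; ≡-dec)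
open import Data.Product using (∃; _×_; _,_)
open import Data.Sum using (_⊎_; inj₁; inj₂)
open import Relation.Nullary using (¬_; Dec; does; yes; no; contradiction)
open import Relation.Nullary.Decidable using (_→-dec_; _×-dec_; ¬?; decidable-stable)
open import Relation.Nullary.Reflects using (ofʸ; ofⁿ)
open import Relation.Binary.PropositionalEquality
open import Function using (_∘_; id)
open import Algebra.Properties.Semiring.Sum +-*-semiring
  using (sum; sum-cong-≗; ∑-distrib-+; ∑-comm; *-distribˡ-sum; sum-replicate-zero)

sumFin≡sum : ∀ {n} (f : Fin n → ℕ) → sumFin f ≡ sum f
sumFin≡sum {n} f = trans (cong ListAction.sum (map-tabulate id f)) (sum-tabulate f)
  where
  sum-tabulate : ∀ {n} (f : Fin n → ℕ) → ListAction.sum (List.tabulate f) ≡ sum f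
  sum-tabulate {zero}  f = refl
  sum-tabulate {suc n} f = cong (f zero +_) (sum-tabulate (f ∘ suc))

sum-const : ∀ n c → sum {n} (λ _ → c) ≡ n * c
sum-const zero    c = refl
sum-const (suc n) c = cong (c +_) (sum-const n c)

sum-mono : ∀ {n} {f g : Fin n → ℕ} → (∀ i → f i ≤ g i) → sum f ≤ sum g
sum-mono {zero}  f≤g = z≤n
sum-mono {suc n} f≤g = +-mono-≤ (f≤g zero) (sum-mono (f≤g ∘ suc))

term≤sum : ∀ {n} (f : Fin n → ℕ) i → f i ≤ sum f
term≤sum f zero    = m≤m+n _ _
term≤sum f (suc i) = ≤-trans (term≤sum (f ∘ suc) i) (m≤n+m _ (f zero))

positive-term : ∀ {n} (f : Fin n → ℕ) → 0 < sum f → ∃ λ i → 0 < f i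
positive-term {zero}  f ()
positive-term {suc n} f pos with f zero in eq
... | suc _ = zero , subst (0 <_) (sym eq) z<s
... | zero  = let i , fi = positive-term (f ∘ suc) pos in suc i , fi

single : ∀ {n} → Fin n → ℕ → Fin n → ℕ
single a c j = if does (a ≟ j) then c else 0

sum-single : ∀ {n} (a : Fin n) c → sum (single a c) ≡ c
sum-single {suc n} zero    c = trans (cong (c +_) (sum-replicate-zero n)) (+-identityʳ c)
sum-single {suc n} (suc a) c = sum-single a c

χ : Bool → ℕ
χ b = if b then 1 else 0

∣∣≡sum : ∀ {m} (S : Subset m) → ∣ S ∣ ≡ sum (λ j → χ (lookup S j))
∣∣≡sum []          = refl
∣∣≡sum (true ∷ S)  = cong suc (∣∣≡sum S)
∣∣≡sum (false ∷ S) = ∣∣≡sum S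

∈-tabulate⁺ : ∀ {m} {f : Fin m → Bool} {j} → f j ≡ true → j ∈ tabulate f
∈-tabulate⁺ {f = f} {j} fj = lookup⇒[]= j (tabulate f) (trans (lookup∘tabulate f j) fj)

∈-tabulate⁻ : ∀ {m} {f : Fin m → Bool} {j} → j ∈ tabulate f → f j ≡ true
∈-tabulate⁻ {f = f} {j} j∈ = trans (sym (lookup∘tabulate f j)) ([]=⇒lookup j∈)

∣p∪⁅x⁆∣≤1+∣p∣ : ∀ {m} (p : Subset m) x → ∣ p ∪ ⁅ x ⁆ ∣ ≤ suc ∣ p ∣
∣p∪⁅x⁆∣≤1+∣p∣ (true  ∷ p) zero    = m≤n⇒m≤1+n (≤-reflexive (cong (suc ∘ ∣_∣) (∪-identityʳ p)))
∣p∪⁅x⁆∣≤1+∣p∣ (false ∷ p) zero    = ≤-reflexive (cong (suc ∘ ∣_∣) (∪-identityʳ p))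
∣p∪⁅x⁆∣≤1+∣p∣ (true  ∷ p) (suc x) = s≤s (∣p∪⁅x⁆∣≤1+∣p∣ p x)
∣p∪⁅x⁆∣≤1+∣p∣ (false ∷ p) (suc x) = ∣p∪⁅x⁆∣≤1+∣p∣ p x

⊆-card-equal : ∀ {m} {p q : Subset m} → p ⊆ q → ∣ q ∣ ≤ ∣ p ∣ → p ≡ q
⊆-card-equal {p = []}        {[]}        _   _ = refl
⊆-card-equal {p = true ∷ p}  {true ∷ q}  p⊆q (s≤s le) = cong (true ∷_) (⊆-card-equal (drop-∷-⊆ p⊆q) le)
⊆-card-equal {p = false ∷ p} {false ∷ q} p⊆q le = cong (false ∷_) (⊆-card-equal (drop-∷-⊆ p⊆q) le)
⊆-card-equal {p = true ∷ p}  {false ∷ q} p⊆q le with () ← p⊆q here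
⊆-card-equal {p = false ∷ p} {true ∷ q}  p⊆q le =
  contradiction (≤-trans (s≤s (p⊆q⇒∣p∣≤∣q∣ (drop-∷-⊆ p⊆q))) le) (<-irrefl refl)

escape : ∀ {m} (S U : Subset m) → ¬ (S ⊆ U) → ∃ λ j → j ∈ S × j ∉ U
escape {m} S U S⊈U
  with j , ¬[j∈S→j∈U] ← ¬∀⟶∃¬ m (λ j → j ∈ S → j ∈ U) (λ j → (j ∈? S) →-dec (j ∈? U)) (λ h → S⊈U (h _))
  with j ∈? S
... | yes j∈S = j , j∈S , λ j∈U → ¬[j∈S→j∈U] (λ _ → j∈U)
... | no  j∉S = contradiction (λ j∈S → contradiction j∈S j∉S) ¬[j∈S→j∈U]

escape-distinct : ∀ {m} (S T : Subset m) → ∣ T ∣ ≤ ∣ S ∣ → S ≢ T → ∃ λ j → j ∈ S × j ∉ T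
escape-distinct S T ∣T∣≤∣S∣ S≢T = escape S T (λ S⊆T → S≢T (⊆-card-equal S⊆T ∣T∣≤∣S∣))

dual-size : ∀ {n m} (B : Fin n → Subset m) → sum (λ j → ∣ dualFamily B j ∣) ≡ sum (λ i → ∣ B i ∣)
dual-size {n} {m} B = begin
  sum (λ j → ∣ dualFamily B j ∣)                      ≡⟨ sum-cong-≗ (λ j → ∣∣≡sum (dualFamily B j)) ⟩
  sum (λ j → sum (λ i → χ (lookup (dualFamily B j) i))) ≡⟨ sum-cong-≗ (λ j → sum-cong-≗ (λ i →
                                                           cong χ (lookup∘tabulate (λ i → lookup (B i) j) i))) ⟩
  sum (λ j → sum (λ i → χ (lookup (B i) j)))           ≡⟨ ∑-comm (λ j i → χ (lookup (B i) j)) ⟩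
  sum (λ i → sum (λ j → χ (lookup (B i) j)))           ≡⟨ sum-cong-≗ (λ i → ∣∣≡sum (B i)) ⟨
  sum (λ i → ∣ B i ∣)                                  ∎
  where open ≡-Reasoning

⊈-by-size : ∀ {m} {S U : Subset m} → ∣ U ∣ < ∣ S ∣ → ¬ (S ⊆ U)
⊈-by-size ∣U∣<∣S∣ S⊆U = <⇒≱ ∣U∣<∣S∣ (p⊆q⇒∣p∣≤∣q∣ S⊆U)

remove : ∀ {n} → Fin n → (Fin n → ℕ) → Fin n → ℕ
remove a q i = q i ∸ single a 1 i

remove-split : ∀ {n} (a : Fin n) (q : Fin n → ℕ) → 0 < q a → ∀ i → single a 1 i + remove a q i ≡ q i
remove-split a q qa i with a ≟ i
... | yes refl = m+[n∸m]≡n qa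
... | no  _    = refl

remove-other : ∀ {n} {a i : Fin n} (q : Fin n → ℕ) → a ≢ i → remove a q i ≡ q i
remove-other {a = a} {i} q a≢i with a ≟ i
... | yes a≡i = contradiction a≡i a≢i
... | no  _   = refl

remove-sum : ∀ {n} (a : Fin n) (q : Fin n → ℕ) → 0 < q a → sum q ≡ suc (sum (remove a q))
remove-sum a q qa = begin
  sum q                                         ≡⟨ sum-cong-≗ (remove-split a q qa) ⟨
  sum (λ i → single a 1 i + remove a q i)       ≡⟨ ∑-distrib-+ (single a 1) (remove a q) ⟩
  sum (single a 1) + sum (remove a q)           ≡⟨ cong (_+ sum (remove a q)) (sum-single a 1) ⟩
  suc (sum (remove a q))                        ∎
  where open ≡-Reasoning

copiesBelow : ∀ {n m} → ℕ → (Fin n → Subset m) → Subset m → ℕ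
copiesBelow A B S = sum (λ i → χ ((toℕ i <ᵇ A) ∧ (B i ≟ˢ S)))

concentrated-size : ∀ {n m} (B : Fin n → Subset m) (S : Subset m) (A r : ℕ) (q : Fin n → ℕ) →
                    (∀ i → q i ≤ r) → (∀ i → 0 < q i → toℕ i < A × B i ≡ S) →
                    sum q ≤ r * copiesBelow A B S
concentrated-size B S A r q q≤r concentrated = begin
  sum q                                                 ≤⟨ sum-mono bound ⟩
  sum (λ i → r * χ ((toℕ i <ᵇ A) ∧ (B i ≟ˢ S)))         ≡⟨ *-distribˡ-sum r (λ i → χ ((toℕ i <ᵇ A) ∧ (B i ≟ˢ S))) ⟨
  r * copiesBelow A B S                                 ∎
  where
  open ≤-Reasoning
  bound : ∀ i → q i ≤ r * χ ((toℕ i <ᵇ A) ∧ (B i ≟ˢ S))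
  bound i with q i in qi
  ... | zero  = z≤n
  ... | suc _ with i<A , Bi≡S ← concentrated i (subst (0 <_) (sym qi) z<s)
              with toℕ i <ᵇ A | <⇒<ᵇ i<A | ≡-dec Bool._≟_ (B i) S
  ...   | true | _ | yes _   = subst (_≤ r * 1) qi (subst (q i ≤_) (sym (*-identityʳ r)) (q≤r i))
  ...   | true | _ | no Bi≢S = contradiction Bi≡S Bi≢S

count-below : ∀ n a → a ≤ n → sum {n} (λ i → χ (toℕ i <ᵇ a)) ≡ a
count-below zero    zero    _       = refl
count-below (suc n) zero    _       = sum-replicate-zero (suc n)
count-below (suc n) (suc a) (s≤s a≤n) = cong suc (count-below n a a≤n)

total-size : ∀ {n m} k A (B : Fin n → Subset m) → 0 < k → A ≤ n →
             (∀ i → toℕ i < A → ∣ B i ∣ ≡ k ∸ 1) → (∀ i → A ≤ toℕ i → ∣ B i ∣ ≡ k) →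
             k * n ∸ A ≡ sumFin (λ j → ∣ dualFamily B j ∣)
total-size {n} k A B 0<k A≤n small large = begin
  k * n ∸ A                                                 ≡⟨ cong (_∸ A) (trans (*-comm k n) (sym (sum-const n k))) ⟩
  sum {n} (λ _ → k) ∸ A                                     ≡⟨ cong (_∸ A) (sum-cong-≗ sizes) ⟨
  sum (λ i → ∣ B i ∣ + χ (toℕ i <ᵇ A)) ∸ A                  ≡⟨ cong (_∸ A) (∑-distrib-+ (λ i → ∣ B i ∣) (λ i → χ (toℕ i <ᵇ A))) ⟩
  sum (λ i → ∣ B i ∣) + sum {n} (λ i → χ (toℕ i <ᵇ A)) ∸ A  ≡⟨ cong (λ c → sum (λ i → ∣ B i ∣) + c ∸ A) (count-below n A A≤n) ⟩
  sum (λ i → ∣ B i ∣) + A ∸ A                               ≡⟨ m+n∸n≡m _ A ⟩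
  sum (λ i → ∣ B i ∣)                                       ≡⟨ dual-size B ⟨
  sum (λ j → ∣ dualFamily B j ∣)                            ≡⟨ sumFin≡sum (λ j → ∣ dualFamily B j ∣) ⟨
  sumFin (λ j → ∣ dualFamily B j ∣)                         ∎
  where
  open ≡-Reasoning
  sizes : ∀ i → ∣ B i ∣ + χ (toℕ i <ᵇ A) ≡ k
  sizes i with toℕ i <ᵇ A | <ᵇ-reflects-< (toℕ i) A
  ... | true  | ofʸ i<A = trans (cong (_+ 1) (small i i<A)) (m∸n+n≡m 0<k)
  ... | false | ofⁿ i≮A = trans (+-identityʳ _) (large i (≮⇒≥ i≮A))

-- Partial assignments of servers to items, for a fixed family of blocks B
-- (B i is the set of servers storing item i, so C_j = dualFamily B j).
module Assignments {n m : ℕ} (B : Fin n → Subset m) where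

  Assignment : Set
  Assignment = Fin m → Maybe (Fin n)

  Valid : Assignment → Set
  Valid d = ∀ j i → d j ≡ just i → j ∈ B i

  load : Assignment → Fin n → ℕ
  load d i = sum (λ j → hits (d j) i)

  used : Assignment → Subset m
  used d = tabulate (λ j → is-just (d j))

  empty : Assignment
  empty _ = nothing

  assign : Assignment → Fin m → Fin n → Assignment
  assign d e x j = if does (e ≟ j) then just x else d j

  ∈used : ∀ {d j i} → d j ≡ just i → j ∈ used d
  ∈used dj≡i = ∈-tabulate⁺ (cong is-just dj≡i)

  idle : ∀ {d} j → j ∉ used d → d j ≡ nothing
  idle {d} j j∉used with d j in dj
  ... | nothing = refl
  ... | just i  = contradiction (∈used dj) j∉used

  record Extension (d : Assignment) (q : Fin n → ℕ) (t : ℕ) : Set where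
    field
      result : Assignment
      valid  : Valid result
      keeps  : used d ⊆ used result
      grows  : ∣ used result ∣ ≤ ∣ used d ∣ + t
      loads  : ∀ i → load result i ≡ load d i + q i
  open Extension

  _⨾_ : ∀ {d q q' t t'} (E : Extension d q t) → Extension (result E) q' t' →
        Extension d (λ i → q i + q' i) (t + t')
  _⨾_ {d} {q} {q'} {t} {t'} E E' = record
    { result = result E'
    ; valid  = valid E'
    ; keeps  = keeps E' ∘ keeps E
    ; grows  = ≤-trans (grows E') (≤-trans (+-monoˡ-≤ t' (grows E)) (≤-reflexive (+-assoc _ t t')))
    ; loads  = λ i → trans (loads E' i) (trans (cong (_+ q' i) (loads E i)) (+-assoc (load d i) (q i) (q' i)))
    }

  retarget : ∀ {d q q' t} → (∀ i → q i ≡ q' i) → Extension d q t → Extension d q' t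
  retarget q≗q' E = record
    { result = result E ; valid = valid E ; keeps = keeps E ; grows = grows E
    ; loads  = λ i → trans (loads E i) (cong (_ +_) (q≗q' i))
    }

  serve-at : ∀ {d e x} → Valid d → e ∉ used d → e ∈ B x → Extension d (single x 1) 1
  serve-at {d} {e} {x} v e-idle e∈Bx = record
    { result = assign d e x ; valid = valid′ ; keeps = keeps′ ; grows = grows′ ; loads = loads′ }
    where
    de≡nothing : d e ≡ nothing
    de≡nothing = idle e e-idle

    valid′ : Valid (assign d e x)
    valid′ j i eq with e ≟ j
    valid′ j i refl | yes refl = e∈Bx
    ... | no _ = v j i eq

    stays-busy : ∀ j → is-just (d j) ≡ true → is-just (assign d e x j) ≡ true
    stays-busy j busy with e ≟ j
    ... | yes _ = refl
    ... | no  _ = busy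

    keeps′ : used d ⊆ used (assign d e x)
    keeps′ {j} j∈used = ∈-tabulate⁺ (stays-busy j (∈-tabulate⁻ j∈used))

    busy : used (assign d e x) ⊆ used d ∪ ⁅ e ⁆
    busy {j} j∈used with e ≟ j | ∈-tabulate⁻ j∈used
    ... | yes refl | _    = x∈p∪q⁺ (inj₂ (x∈⁅x⁆ e))
    ... | no  _    | busy = x∈p∪q⁺ (inj₁ (∈-tabulate⁺ busy))

    grows′ : ∣ used (assign d e x) ∣ ≤ ∣ used d ∣ + 1
    grows′ = ≤-trans (p⊆q⇒∣p∣≤∣q∣ busy) (≤-trans (∣p∪⁅x⁆∣≤1+∣p∣ (used d) e) (≤-reflexive (+-comm 1 _)))

    hits-assign : ∀ i j → hits (assign d e x j) i ≡ hits (d j) i + single e (single x 1 i) j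
    hits-assign i j with e ≟ j
    ... | yes refl rewrite de≡nothing = refl
    ... | no  _    = sym (+-identityʳ _)

    loads′ : ∀ i → load (assign d e x) i ≡ load d i + single x 1 i
    loads′ i = begin
      load (assign d e x) i                                   ≡⟨ sum-cong-≗ (hits-assign i) ⟩
      sum (λ j → hits (d j) i + single e (single x 1 i) j)    ≡⟨ ∑-distrib-+ (λ j → hits (d j) i) _ ⟩
      load d i + sum (single e (single x 1 i))                ≡⟨ cong (load d i +_) (sum-single e _) ⟩
      load d i + single x 1 i                                 ∎
      where open ≡-Reasoning

  serve-one : ∀ {d x} → Valid d → ¬ (B x ⊆ used d) → Extension d (single x 1) 1
  serve-one {d} {x} v Bx⊈used =
    let e , e∈Bx , e-idle = escape (B x) (used d) Bx⊈used in serve-at v e-idle e∈Bx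

  serve-greedy : ∀ t (q : Fin n → ℕ) {d} → Valid d → sum q ≡ t →
                 (∀ i → 0 < q i → ∣ used d ∣ + t ≤ ∣ B i ∣) → Extension d q t
  serve-greedy zero q {d} v Σq≡0 _ = record
    { result = d ; valid = v ; keeps = id ; grows = m≤m+n _ 0
    ; loads  = λ i → sym (trans (cong (load d i +_) (nothing-requested i)) (+-identityʳ _))
    }
    where
    nothing-requested : ∀ i → q i ≡ 0
    nothing-requested i = n≤0⇒n≡0 (subst (q i ≤_) Σq≡0 (term≤sum q i))
  serve-greedy (suc t) q {d} v Σq≡1+t fits with positive-term q (subst (0 <_) (sym Σq≡1+t) z<s)
  ... | a , qa = retarget (remove-split a q qa) (first ⨾ serve-greedy t (remove a q) (valid first) Σrest fits-rest)
    where
    room : ∣ used d ∣ < ∣ B a ∣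
    room = ≤-trans (≤-reflexive (+-comm 1 _)) (≤-trans (+-monoʳ-≤ _ (s≤s z≤n)) (fits a qa))

    first : Extension d (single a 1) 1
    first = serve-one v (⊈-by-size room)

    Σrest : sum (remove a q) ≡ t
    Σrest = suc-injective (trans (sym (remove-sum a q qa)) Σq≡1+t)

    fits-rest : ∀ i → 0 < remove a q i → ∣ used (result first) ∣ + t ≤ ∣ B i ∣
    fits-rest i qi = ≤-trans (+-monoˡ-≤ t (grows first))
                       (≤-trans (≤-reflexive (+-assoc _ 1 t)) (fits i (≤-trans qi (m∸n≤m (q i) (single a 1 i)))))

  serves : ∀ {q t} → Extension empty q t → Serves (dualFamily B) q
  serves {q} E = result E , member , enough
    where
    member : ∀ j i → result E j ≡ just i → i ∈ dualFamily B j
    member j i eq = ∈-tabulate⁺ ([]=⇒lookup (valid E j i eq))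

    enough : ∀ i → q i ≤ sumFin (λ j → hits (result E j) i)
    enough i = ≤-reflexive (begin
      q i                                  ≡⟨ cong (_+ q i) (sum-replicate-zero m) ⟨
      load empty i + q i                   ≡⟨ loads E i ⟨
      load (result E) i                    ≡⟨ sumFin≡sum (λ j → hits (result E j) i) ⟨
      sumFin (λ j → hits (result E j) i)   ∎)
      where open ≡-Reasoning

  empty-valid : Valid empty
  empty-valid j i ()

  empty-idle : ∀ j → j ∉ used empty
  empty-idle j j∈used with () ← ∈-tabulate⁻ {f = λ j → is-just (empty j)} j∈used

  ∣used-empty∣ : ∣ used empty ∣ ≡ 0
  ∣used-empty∣ = n≤0⇒n≡0 (≤-trans (p⊆q⇒∣p∣≤∣q∣ {q = ⊥ˢ} (λ {j} j∈used → contradiction j∈used (empty-idle j)))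
                                  (≤-reflexive (∣⊥∣≡0 m)))

  grown-from-empty : ∀ {q t} (E : Extension empty q t) → ∣ used (result E) ∣ ≤ t
  grown-from-empty {t = t} E = ≤-trans (grows E) (≤-reflexive (cong (_+ t) ∣used-empty∣))

  -- Large block: if every block has at least k - 1 servers and some requested item
  -- a has at least k, serve everything but one copy of a greedily, then a last.
  serve-with-large-block : ∀ {k} (q : Fin n → ℕ) (a : Fin n) → (∀ i → k ∸ 1 ≤ ∣ B i ∣) →
                           sum q ≡ k → 0 < q a → k ≤ ∣ B a ∣ → Serves (dualFamily B) q
  serve-with-large-block {k} q a blocks Σq≡k qa k≤∣Ba∣ =
    serves (retarget (λ i → trans (+-comm (remove a q i) _) (remove-split a q qa i)) (rest ⨾ last))
    where
    Σrest : sum (remove a q) ≡ k ∸ 1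
    Σrest = cong (_∸ 1) (trans (sym (remove-sum a q qa)) Σq≡k)

    rest : Extension empty (remove a q) (k ∸ 1)
    rest = serve-greedy (k ∸ 1) (remove a q) empty-valid Σrest (λ i _ → blocks′ i)
      where
      blocks′ : ∀ i → ∣ used empty ∣ + (k ∸ 1) ≤ ∣ B i ∣
      blocks′ i = ≤-trans (≤-reflexive (cong (_+ (k ∸ 1)) ∣used-empty∣)) (blocks i)

    room : ∣ used (result rest) ∣ < ∣ B a ∣
    room = begin-strict
      ∣ used (result rest) ∣   ≤⟨ grown-from-empty rest ⟩
      k ∸ 1                    ≡⟨ Σrest ⟨
      sum (remove a q)         <⟨ n<1+n _ ⟩
      suc (sum (remove a q))   ≡⟨ trans (sym (remove-sum a q qa)) Σq≡k ⟩
      k                        ≤⟨ k≤∣Ba∣ ⟩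
      ∣ B a ∣                  ∎
      where open ≤-Reasoning

    last : Extension (result rest) (single a 1) 1
    last = serve-one (valid rest) (⊈-by-size room)

  assign-busy : ∀ d e x → e ∈ used (assign d e x)
  assign-busy d e x = ∈-tabulate⁺ (self-busy (e ≟ e))
    where
    self-busy : (e≟e : Dec (e ≡ e)) → is-just (if does e≟e then just x else d e) ≡ true
    self-busy (yes _)  = refl
    self-busy (no e≢e) = contradiction refl e≢e

  -- Two distinct requested blocks: if every block has at least k - 1 servers and
  -- e ∈ B i₁ ∖ B i₀ for requested items i₀, i₁, serve i₁ at e, the rest greedily,
  -- and i₀ last: B i₀ is not exhausted because the busy server e lies outside it.
  serve-with-two-blocks : ∀ {k} (q : Fin n → ℕ) {i₀ i₁ e} → (∀ i → k ∸ 1 ≤ ∣ B i ∣) →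
                          sum q ≡ k → 0 < q i₀ → 0 < q i₁ → e ∈ B i₁ → e ∉ B i₀ → Serves (dualFamily B) q
  serve-with-two-blocks {k} q {i₀} {i₁} {e} blocks Σq≡k qi₀ qi₁ e∈Bi₁ e∉Bi₀ =
    serves (retarget split (first ⨾ (middle ⨾ last)))
    where
    i₁≢i₀ : i₁ ≢ i₀
    i₁≢i₀ refl = e∉Bi₀ e∈Bi₁

    q₁ = remove i₁ q
    q₁i₀ : 0 < q₁ i₀
    q₁i₀ = subst (0 <_) (sym (remove-other q i₁≢i₀)) qi₀

    rest = remove i₀ q₁
    t = sum rest

    k∸1≡1+t : k ∸ 1 ≡ suc t
    k∸1≡1+t = cong (_∸ 1) (begin
      k                  ≡⟨ Σq≡k ⟨
      sum q              ≡⟨ remove-sum i₁ q qi₁ ⟩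
      suc (sum q₁)       ≡⟨ cong suc (remove-sum i₀ q₁ q₁i₀) ⟩
      suc (suc t)        ∎)
      where open ≡-Reasoning

    first : Extension empty (single i₁ 1) 1
    first = serve-at empty-valid (empty-idle e) e∈Bi₁

    middle : Extension (result first) rest t
    middle = serve-greedy t rest (valid first) refl (λ i _ → fits i)
      where
      fits : ∀ i → ∣ used (result first) ∣ + t ≤ ∣ B i ∣
      fits i = ≤-trans (+-monoˡ-≤ t (grown-from-empty first)) (≤-trans (≤-reflexive (sym k∸1≡1+t)) (blocks i))

    room : ¬ (B i₀ ⊆ used (result middle))
    room Bi₀⊆used = <⇒≱ (begin-strict
      ∣ used (result middle) - e ∣  <⟨ x∈p⇒∣p-x∣<∣p∣ (keeps middle (assign-busy empty e i₁)) ⟩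
      ∣ used (result middle) ∣      ≤⟨ grows middle ⟩
      ∣ used (result first) ∣ + t   ≤⟨ +-monoˡ-≤ t (grown-from-empty first) ⟩
      suc t                         ≡⟨ k∸1≡1+t ⟨
      k ∸ 1                         ≤⟨ blocks i₀ ⟩
      ∣ B i₀ ∣                      ∎)
      (p⊆q⇒∣p∣≤∣q∣ {q = used (result middle) - e} (λ j∈Bi₀ → x∈p∧x≢y⇒x∈p-y (Bi₀⊆used j∈Bi₀) λ { refl → e∉Bi₀ j∈Bi₀ }))
      where open ≤-Reasoning

    last : Extension (result middle) (single i₀ 1) 1
    last = serve-one (valid middle) room

    split : ∀ i → single i₁ 1 i + (rest i + single i₀ 1 i) ≡ q i
    split i = begin
      single i₁ 1 i + (rest i + single i₀ 1 i)  ≡⟨ cong (single i₁ 1 i +_) (+-comm (rest i) _) ⟩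
      single i₁ 1 i + (single i₀ 1 i + rest i)  ≡⟨ cong (single i₁ 1 i +_) (remove-split i₀ q₁ q₁i₀ i) ⟩
      single i₁ 1 i + q₁ i                      ≡⟨ remove-split i₁ q qi₁ i ⟩
      q i                                       ∎
      where open ≡-Reasoning

  serve-or-concentrated : ∀ {k} (q : Fin n → ℕ) {i₀} → (∀ i → k ∸ 1 ≤ ∣ B i ∣) → sum q ≡ k →
                          0 < q i₀ → ∣ B i₀ ∣ ≤ k ∸ 1 →
                          Serves (dualFamily B) q ⊎ (∀ i → 0 < q i → B i ≡ B i₀)
  serve-or-concentrated q {i₀} blocks Σq≡k qi₀ ∣Bi₀∣≤k∸1
    with any? (λ i → (0 <? q i) ×-dec ¬? (≡-dec Bool._≟_ (B i) (B i₀)))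
  ... | yes (i₁ , qi₁ , Bi₁≢Bi₀) =
    let e , e∈Bi₁ , e∉Bi₀ = escape-distinct (B i₁) (B i₀) (≤-trans ∣Bi₀∣≤k∸1 (blocks i₁)) Bi₁≢Bi₀
    in inj₁ (serve-with-two-blocks q blocks Σq≡k qi₀ qi₁ e∈Bi₁ e∉Bi₀)
  ... | no none = inj₂ λ i qi → decidable-stable (≡-dec Bool._≟_ (B i) (B i₀)) (λ Bi≢Bi₀ → none (i , qi , Bi≢Bi₀))

  module _ {k r A : ℕ} (0<k : 0 < k)
           (small : ∀ i → toℕ i < A → ∣ B i ∣ ≡ k ∸ 1) (large : ∀ i → A ≤ toℕ i → ∣ B i ∣ ≡ k)
           (few : ∀ S → ∣ S ∣ ≡ k ∸ 1 → r * copiesBelow A B S < k) where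

    blocks : ∀ i → k ∸ 1 ≤ ∣ B i ∣
    blocks i with toℕ i <? A
    ... | yes i<A = ≤-reflexive (sym (small i i<A))
    ... | no  i≮A = subst (k ∸ 1 ≤_) (sym (large i (≮⇒≥ i≮A))) (m∸n≤m k 1)

    -- A request among the small blocks is served through two distinct blocks,
    -- since it cannot be concentrated on the copies of one (k-1)-set.
    serve-small : ∀ q → sum q ≡ k → (∀ i → q i ≤ r) → (∀ {i} → 0 < q i → toℕ i < A) →
                  Serves (dualFamily B) q
    serve-small q Σq≡k q≤r below with positive-term q (subst (0 <_) (sym Σq≡k) 0<k)
    ... | i₀ , qi₀ with serve-or-concentrated q blocks Σq≡k qi₀ (≤-reflexive (small i₀ (below qi₀)))
    ...   | inj₁ served       = served
    ...   | inj₂ concentrated =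
      contradiction (few (B i₀) (small i₀ (below qi₀)))
        (≤⇒≯ (subst (_≤ r * copiesBelow A B (B i₀)) Σq≡k
               (concentrated-size B (B i₀) A r q q≤r (λ i qi → below qi , concentrated i qi))))

    serve-all : ∀ q → sum q ≡ k → (∀ i → q i ≤ r) → Serves (dualFamily B) q
    serve-all q Σq≡k q≤r with any? (λ a → (0 <? q a) ×-dec (A ≤? toℕ a))
    ... | yes (a , qa , A≤a) = serve-with-large-block q a blocks Σq≡k qa (≤-reflexive (sym (large a A≤a)))
    ... | no no-large        = serve-small q Σq≡k q≤r (λ {i} qi → ≰⇒> (λ A≤i → no-large (i , qi , A≤i)))

theorem8 : (n k m r : ℕ) → 0 < n → 0 < k → 0 < m → .{{_ : NonZero r}} → r < k → k ≤ m →
    n ≥ ((k ∸ 1) / r) * (m C (k ∸ 1)) →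
    (B : Fin n → Subset m) →
    (∀ (i : Fin n) → toℕ i < ((k ∸ 1) / r) * (m C (k ∸ 1)) → ∣ B i ∣ ≡ k ∸ 1) →
    (∀ (S : Subset m) → ∣ S ∣ ≡ k ∸ 1 →
      countFin (λ i → (toℕ i <ᵇ ((k ∸ 1) / r) * (m C (k ∸ 1))) ∧ (B i ≟ˢ S)) ≡ (k ∸ 1) / r) →
    (∀ (i : Fin n) → ((k ∸ 1) / r) * (m C (k ∸ 1)) ≤ toℕ i → ∣ B i ∣ ≡ k) →
    IsMCBC n (k * n ∸ ((k ∸ 1) / r) * (m C (k ∸ 1))) k m r (dualFamily B)
theorem8 n k m r _ 0<k _ _ _ A≤n B small copies large =
  total-size k A B 0<k A≤n small large ,
  λ q (Σq≡k , q≤r) → serve-all 0<k small large few q (trans (sym (sumFin≡sum q)) Σq≡k) q≤r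
  where
  open Assignments B
  A = ((k ∸ 1) / r) * (m C (k ∸ 1))

  few : ∀ S → ∣ S ∣ ≡ k ∸ 1 → r * copiesBelow A B S < k
  few S ∣S∣≡k∸1 = begin-strict
    r * copiesBelow A B S   ≡⟨ cong (r *_) (trans (sym (sumFin≡sum {n} _)) (copies S ∣S∣≡k∸1)) ⟩
    r * ((k ∸ 1) / r)       ≡⟨ *-comm r _ ⟩
    (k ∸ 1) / r * r         ≤⟨ m/n*n≤m (k ∸ 1) r ⟩
    k ∸ 1                   <⟨ ∸-monoʳ-< z<s 0<k ⟩
    k                       ∎
    where open ≤-Reasoning
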